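{- For any positive integer $n$, at least $n-1$ bits are necessary to answer RMQ on a 1D binary array $A[1..n]$ (entries in $\{0,1\}$).
   Context: For $1\le i\le j\le n$, $\mathsf{rmq}(i,j)$ returns the position of a smallest element of $A[i..j]$, breaking ties by returning the leftmost such position; RMQ means all such queries. "At least $X$ bits are necessary" means that the number of distinct answer functions (query $\mapsto$ answer) induced by all admissible input arrays is at least $2^X$, so any encoding from which all answers can be recovered without the input uses at least $X$ bits for some input. -}

module Defs where

open import Data.Nat using (ℕ; _≤_; _≤?_; _∸_; _^_)
open import Data.Bool using (Bool; true; false)
open import Data.Fin using (Fin; toℕ)
open import Data.List using (List; []; _∷_; filter; allFin)
open import Data.Product using (Σ; _×_; _,_; proj₁)
open import Relation.Nullary using (¬_)
open import Relation.Binary.PropositionalEquality using (_≡_)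
open import Relation.Nullary.Decidable using (_×-dec_)

-- A binary array A[1..n], positions indexed by Fin n (0-based), entries 0 = false, 1 = true.
BinArray : ℕ → Set
BinArray n = Fin n → Bool

_<ᵇ_ : Bool → Bool → Bool
false <ᵇ true = true
_     <ᵇ _    = false

scanMin : ∀ {n} → BinArray n → Fin n → List (Fin n) → Fin n
scanMin A best []       = best
scanMin A best (k ∷ ks) with A k <ᵇ A best
... | true  = scanMin A k ks
... | false = scanMin A best ks

range : ∀ {n} → Fin n → Fin n → List (Fin n)
range {n} i j = filter (λ k → (toℕ i ≤? toℕ k) ×-dec (toℕ k ≤? toℕ j)) (allFin n)

Query : ℕ → Set
Query n = Σ (Fin n × Fin n) (λ p → toℕ (Data.Product.proj₁ p) ≤ toℕ (Data.Product.proj₂ p))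

-- rmq(i,j): position of the leftmost smallest element of A[i..j]
rmq : ∀ {n} → BinArray n → Fin n → Fin n → Fin n
rmq A i j = scanMin A i (range i j)

answers : ∀ {n} → BinArray n → Query n → Fin n
answers A ((i , j) , _) = rmq A i j

DistinctAnswers : ∀ {n} → BinArray n → BinArray n → Set
DistinctAnswers {n} A B = Σ (Query n) (λ q → ¬ (answers A q ≡ answers B q))

-- there are at least 2^X distinct answer functions over binary arrays of length n:
-- a family of 2^X arrays whose answer functions are pairwise distinct
AtLeastBitsNecessary : ℕ → ℕ → Set
AtLeastBitsNecessary n X =
  Σ (Fin (2 ^ X) → BinArray n)
    (λ f → ∀ a b → ¬ (a ≡ b) → DistinctAnswers (f a) (f b))

{-# OPTIONS --safe #-}
-- Fix the last entry to 0 and let the first n − 1 entries be arbitrary. For k < n − 1 the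
-- query rmq(k, n − 1) returns k exactly when A[k] = 0: a 0 at the left end is never
-- displaced, while a 1 there is displaced by the 0 at the right end. So the answer function
-- determines the first n − 1 bits, and the 2^(n−1) such arrays have distinct answer functions.
module Submission where

open import Defs
open import Data.Nat using (ℕ; zero; suc; _∸_; _≤_; _^_)
open import Data.Nat.Properties using (≤-refl)
open import Data.Bool using (Bool; true; false)
import Data.Bool.Properties as Bool
open import Data.Fin using (Fin; zero; suc; toℕ; inject₁; fromℕ; combine; finToFun; funToFin)
open import Data.Fin.Properties using (≤fromℕ; funToFin-finToFin; ¬∀⟶∃¬; 2↔Bool)
open import Data.List using ([]; _∷_)
open import Data.List.Relation.Unary.Any using (Any; here; there)
import Data.List.Relation.Unary.Any as Any
open import Data.List.Membership.Propositional.Properties using (∈-filter⁺; ∈-allFin)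
open import Data.Product using (∃; _,_)
open import Data.Vec.Functional using (Vector)
open import Function using (_∘_; Inverse; Injection)
open import Function.Properties.Inverse using (↔⇒↣)
open import Relation.Binary.PropositionalEquality

private
  variable
    n : ℕ

<ᵇ⇒≡false : ∀ {x y} → x <ᵇ y ≡ true → x ≡ false
<ᵇ⇒≡false {false} {true} _ = refl

<ᵇ⇒≡true : ∀ {x y} → x <ᵇ y ≡ true → y ≡ true
<ᵇ⇒≡true {false} {true} _ = refl

false≮ᵇ⇒≡false : ∀ {y} → false <ᵇ y ≡ false → y ≡ false
false≮ᵇ⇒≡false {false} _ = refl

scanMin-keeps-zero : ∀ (A : BinArray n) {best} ks → A best ≡ false → scanMin A best ks ≡ best
scanMin-keeps-zero A         []       _    = refl
scanMin-keeps-zero A {best} (k ∷ ks) best₀ with A k <ᵇ A best in lt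
... | true  with () ← trans (sym best₀) (<ᵇ⇒≡true lt)
... | false = scanMin-keeps-zero A ks best₀

scanMin-finds-zero : ∀ (A : BinArray n) {best} ks →
                Any (λ k → A k ≡ false) ks → A (scanMin A best ks) ≡ false
scanMin-finds-zero A {best} (k ∷ ks) zeros with A k <ᵇ A best in lt
... | true  = let k₀ = <ᵇ⇒≡false lt in trans (cong A (scanMin-keeps-zero A ks k₀)) k₀
scanMin-finds-zero A        (k ∷ ks) (there zeros) | false = scanMin-finds-zero A ks zeros
scanMin-finds-zero A {best} (k ∷ ks) (here k₀)     | false =
  trans (cong A (scanMin-keeps-zero A ks best₀)) best₀
  where best₀ = false≮ᵇ⇒≡false (subst (λ x → x <ᵇ A best ≡ false) k₀ lt)

rmq≡start : ∀ (A : BinArray n) {i} j → A i ≡ false → rmq A i j ≡ i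
rmq≡start A {i} j = scanMin-keeps-zero A (range i j)

rmq-finds-zero : ∀ (A : BinArray n) {i j : Fin n} → toℕ i ≤ toℕ j → A j ≡ false → A (rmq A i j) ≡ false
rmq-finds-zero A {i} {j} i≤j j₀ = scanMin-finds-zero A (range i j)
  (Any.map (λ { refl → j₀ }) (∈-filter⁺ _ (∈-allFin j) (i≤j , ≤-refl)))

rmq-determines-start : ∀ (A B : BinArray n) {i j : Fin n} → toℕ i ≤ toℕ j →
                       A j ≡ false → B j ≡ false → rmq A i j ≡ rmq B i j → A i ≡ B i
rmq-determines-start A B {i} {j} i≤j Aj₀ Bj₀ same with A i in Ai | B i in Bi
... | false | false = refl
... | true  | true  = refl
... | false | true  with () ← trans (sym Bi) (subst (λ x → B x ≡ false)
                                (trans (sym same) (rmq≡start A j Ai)) (rmq-finds-zero B i≤j Bj₀))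
... | true  | false with () ← trans (sym Ai) (subst (λ x → A x ≡ false)
                                (trans same (rmq≡start B j Bi)) (rmq-finds-zero A i≤j Aj₀))

infixl 5 _∷ʳ_

_∷ʳ_ : ∀ {a} {A : Set a} {m} → Vector A m → A → Vector A (suc m)
_∷ʳ_ {m = zero}  f x _       = x
_∷ʳ_ {m = suc m} f x zero    = f zero
_∷ʳ_ {m = suc m} f x (suc i) = (f ∘ suc ∷ʳ x) i

∷ʳ-fromℕ : ∀ {a} {A : Set a} {m} (f : Vector A m) x → (f ∷ʳ x) (fromℕ m) ≡ x
∷ʳ-fromℕ {m = zero}  f x = refl
∷ʳ-fromℕ {m = suc m} f x = ∷ʳ-fromℕ (f ∘ suc) x

∷ʳ-inject₁ : ∀ {a} {A : Set a} {m} (f : Vector A m) x k → (f ∷ʳ x) (inject₁ k) ≡ f k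
∷ʳ-inject₁ f x zero    = refl
∷ʳ-inject₁ f x (suc k) = ∷ʳ-inject₁ (f ∘ suc) x k

funToFin-cong : ∀ {m k} {f g : Fin m → Fin k} → f ≗ g → funToFin f ≡ funToFin g
funToFin-cong {zero}  f≗g = refl
funToFin-cong {suc m} f≗g = cong₂ combine (f≗g zero) (funToFin-cong (f≗g ∘ suc))

finToFun-injective : ∀ {m k} {a b : Fin (k ^ m)} → finToFun {k} {m} a ≗ finToFun b → a ≡ b
finToFun-injective {m} {k} {a} {b} a≗b = begin
  a                                ≡⟨ funToFin-finToFin {m} {k} a ⟨
  funToFin (finToFun {k} {m} a)    ≡⟨ funToFin-cong a≗b ⟩
  funToFin (finToFun {k} {m} b)    ≡⟨ funToFin-finToFin {m} {k} b ⟩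
  b                                ∎
  where open ≡-Reasoning

bitPattern : ∀ {m} → Fin (2 ^ m) → Vector Bool m
bitPattern {m} a = Inverse.to 2↔Bool ∘ finToFun {2} {m} a

bitPattern-differ : ∀ {m} {a b : Fin (2 ^ m)} → a ≢ b → ∃ λ k → bitPattern a k ≢ bitPattern b k
bitPattern-differ {m} a≢b = ¬∀⟶∃¬ m _ (λ k → _ Bool.≟ _)
  (a≢b ∘ finToFun-injective {m} ∘ (Injection.injective (↔⇒↣ 2↔Bool) ∘_))

separating⇒AtLeastBitsNecessary : ∀ {m} (arr : Vector Bool m → BinArray n) →
  (∀ {f g} k → f k ≢ g k → DistinctAnswers (arr f) (arr g)) → AtLeastBitsNecessary n m
separating⇒AtLeastBitsNecessary arr separates =
  arr ∘ bitPattern , λ a b a≢b → let k , differ = bitPattern-differ a≢b in separates k differ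

lemma2 : (n : ℕ) → 1 ≤ n → AtLeastBitsNecessary n (n ∸ 1)
lemma2 (suc m) _ = separating⇒AtLeastBitsNecessary (_∷ʳ false) separates
  where
  separates : ∀ {f g : Vector Bool m} k → f k ≢ g k → DistinctAnswers (f ∷ʳ false) (g ∷ʳ false)
  separates {f} {g} k fk≢gk = ((inject₁ k , fromℕ m) , ≤fromℕ (inject₁ k)) , λ same →
    fk≢gk (begin
      f k                        ≡⟨ ∷ʳ-inject₁ f false k ⟨
      (f ∷ʳ false) (inject₁ k)   ≡⟨ rmq-determines-start (f ∷ʳ false) (g ∷ʳ false) (≤fromℕ (inject₁ k))
                                      (∷ʳ-fromℕ f false) (∷ʳ-fromℕ g false) same ⟩
      (g ∷ʳ false) (inject₁ k)   ≡⟨ ∷ʳ-inject₁ g false k ⟩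
      g k                        ∎)
    where open ≡-Reasoning
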